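{- Let $\Sigma$ be an alphabet, $k\in\mathbb{N}$ and $A,B\subseteq\Sigma^*$. Suppose there are $w\in A$ and $w'\in B$ that differ from each other only by the lengths of one or more chains of symbols, each of these chains having length more than $k$ in both $w$ and $w'$; i.e. there are $m\ge1$, words $x_0,\dots,x_m$, letters $c_1,\dots,c_m\in\Sigma$ and integers $p_j,q_j>k$ such that $w=x_0c_1^{p_1}x_1c_2^{p_2}\cdots c_m^{p_m}x_m$, $w'=x_0c_1^{q_1}x_1c_2^{q_2}\cdots c_m^{q_m}x_m$, and each block $c_j^{p_j}$ (resp. $c_j^{q_j}$) is a maximal block of consecutive occurrences of $c_j$ in $w$ (resp. $w'$). Then D has a winning strategy in the game $\mathrm{GRES}(k,0,A,B)$ (equivalently, from any position $(k,0,A,B)$ of any game $\mathrm{GRES}(k_0,s_0,A_0,B_0)$).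
   Context: For $a\in\Sigma$, an $a$-chain in a word is a maximal block of consecutive occurrences of $a$. For a word $w$, $\mathrm{Sp}^n(w)=\{(w_1,\dots,w_n)\mid w_1\cdots w_n=w\}$, $\mathrm{Sp}(w)=\bigcup_n\mathrm{Sp}^n(w)$, $[n]=\{1,\dots,n\}$. The game $\mathrm{GRES}(k_0,s_0,A_0,B_0)$ ($k_0\ge s_0$) between players S and D has positions $(k,s,A,B)$ with $A,B\subseteq\Sigma^*$, $k,s\in\mathbb{N}$, $k\ge s$; it starts at $(k_0,s_0,A_0,B_0)$. At position $(k,s,A,B)$: if $k=0$, D wins. Otherwise S chooses one move: (a-move) S chooses $a\in\Sigma\cup\{\epsilon\}$; S wins if $A\subseteq\{a\}$ and $a\notin B$, otherwise D wins. ($\emptyset$-move) S wins if $A=\emptyset$, otherwise D wins. ($\cup$-move) S chooses $A_1,A_2\subseteq A$ with $A_1\cup A_2=A$ and naturals $k_1,k_2,s_1,s_2$ with $k_i\ge s_i$, $k_1+k_2+1=k$, $s_1+s_2=s$; D chooses $i\in\{1,2\}$; play continues from $(k_i,s_i,A_i,B)$. (cat-move) For every $w\in A$, S chooses $(w_1,w_2)\in\mathrm{Sp}^2(w)$; let $A_i=\{w_i\mid w\in A\}$. For every $v\in B$, S chooses $f_v:\mathrm{Sp}^2(v)\to\{1,2\}$; let $B_i=\{v_i\mid v\in B,(v_1,v_2)\in\mathrm{Sp}^2(v), f_v(v_1,v_2)=i\}$. S chooses $k_1,k_2,s_1,s_2$ as in the $\cup$-move; D chooses $i\in\{1,2\}$;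 play continues from $(k_i,s_i,A_i,B_i)$. ($*$-move, only available when $s\ge1$) If $\epsilon\in B$, D wins. Otherwise for every $w\in A\setminus\{\epsilon\}$ S chooses $n(w)>0$ and a split $(w_1,\dots,w_{n(w)})\in\mathrm{Sp}^{n(w)}(w)$ with all $w_i\ne\epsilon$; let $A'$ be the set of all these pieces. For every $v\in B$, S chooses $f_v$ assigning to each $(v_1,\dots,v_n)\in\mathrm{Sp}(v)$ an index in $[n]$; let $B'=\{v_i\mid v\in B,(v_1,\dots,v_n)\in\mathrm{Sp}(v),f_v(v_1,\dots,v_n)=i\}$. Play continues from $(k-1,s-1,A',B')$. ($\neg$-move) Play continues from $(k-1,s,B,A)$. -}

module Defs where

open import Level using (0ℓ)
open import Data.Nat using (ℕ; zero; suc; _+_; _≤_)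
open import Data.Fin using (Fin)
open import Data.Maybe using (Maybe; just; nothing)
open import Data.List using (List; []; _∷_; _++_; concat; replicate; length; lookup; head; last)
open import Data.List.Relation.Unary.All using (All)
open import Data.Product using (Σ; ∃; _×_; _,_; proj₁; proj₂)
open import Data.Sum using (_⊎_)
open import Relation.Nullary using (¬_)
open import Relation.Binary.PropositionalEquality using (_≡_; _≢_)
import Data.List.Membership.Propositional as LM

Lang : Set → Set₁
Lang S = List S → Set

_⊆L_ : {S : Set} → Lang S → Lang S → Set
A ⊆L B = ∀ w → A w → B w

-- The word denoted by a ∈ Σ ∪ {ε}: nothing stands for ε.
toWord : {S : Set} → Maybe S → List S
toWord nothing  = []
toWord (just a) = a ∷ []

Sp2 : {S : Set} → List S → Set
Sp2 {S} w = Σ (List S × List S) λ p → proj₁ p ++ proj₂ p ≡ w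

-- Splits of w into nonempty pieces (for w ≠ ε these are exactly the
-- splits with n(w) > 0 and all pieces nonempty; for w = ε only the empty split).
NESplit : {S : Set} → List S → Set
NESplit {S} w = Σ (List (List S)) λ ps → concat ps ≡ w × All (λ p → p ≢ []) ps

-- A cat-move of S given A, B: splits σ of words of A and, for words v, the
-- assignment f v₁ v₂ ∈ {1,2} (Fin 2) for the split (v₁ , v₂) of v = v₁ v₂.
catA₁ catA₂ : {S : Set} → Lang S → ((w : List S) → Sp2 w) → Lang S
catA₁ A σ u = ∃ λ w → A w × proj₁ (proj₁ (σ w)) ≡ u
catA₂ A σ u = ∃ λ w → A w × proj₂ (proj₁ (σ w)) ≡ u

catB₁ catB₂ : {S : Set} → Lang S → (List S → List S → Fin 2) → Lang S
catB₁ B f u = ∃ λ v₂ → B (u ++ v₂) × f u v₂ ≡ Fin.zero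
  where import Data.Fin as Fin
catB₂ B f u = ∃ λ v₁ → B (v₁ ++ u) × f v₁ u ≡ Fin.suc Fin.zero
  where import Data.Fin as Fin

-- A *-move: τ gives for every word a split into nonempty pieces;
-- g assigns to every split (v₁,…,vₙ), n ≥ 1, of any word v = v₁⋯vₙ an index in [n]
-- (the split is the list p ∷ ps, the index ranges over Fin (length (p ∷ ps))).
starA : {S : Set} → Lang S → ((w : List S) → NESplit w) → Lang S
starA A τ u = ∃ λ w → A w × LM._∈_ u (proj₁ (τ w))

starB : {S : Set} → Lang S
      → ((p : List S) (ps : List (List S)) → Fin (length (p ∷ ps))) → Lang S
starB B g u = Σ (List _) λ p → Σ (List (List _)) λ ps →
  B (concat (p ∷ ps)) × lookup (p ∷ ps) (g p ps) ≡ u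

-- The game has depth at most k, so winning strategies are given inductively:
-- D wins iff k = 0, or every move of S leads to a D-win.
data DWins {S : Set} : ℕ → ℕ → Lang S → Lang S → Set₁ where
  dw-zero : ∀ {s A B} → DWins zero s A B
  dw-suc  : ∀ {k s A B} →
    -- a-moves: S does not win
    (∀ (a : Maybe S) → ¬ ((∀ u → A u → u ≡ toWord a) × ¬ B (toWord a))) →
    -- ∅-move: A is not empty
    ¬ (∀ w → ¬ A w) →
    -- ∪-moves
    (∀ (A₁ A₂ : Lang S) (k₁ k₂ s₁ s₂ : ℕ) →
       A₁ ⊆L A → A₂ ⊆L A → (∀ w → A w → A₁ w ⊎ A₂ w) →
       s₁ ≤ k₁ → s₂ ≤ k₂ → k₁ + k₂ + 1 ≡ suc k → s₁ + s₂ ≡ s →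
       DWins k₁ s₁ A₁ B ⊎ DWins k₂ s₂ A₂ B) →
    -- cat-moves
    (∀ (σ : (w : List S) → Sp2 w) (f : List S → List S → Fin 2) (k₁ k₂ s₁ s₂ : ℕ) →
       s₁ ≤ k₁ → s₂ ≤ k₂ → k₁ + k₂ + 1 ≡ suc k → s₁ + s₂ ≡ s →
       DWins k₁ s₁ (catA₁ A σ) (catB₁ B f) ⊎ DWins k₂ s₂ (catA₂ A σ) (catB₂ B f)) →
    -- *-moves (only when s ≥ 1)
    (∀ s' → s ≡ suc s' →
       B [] ⊎ (∀ (τ : (w : List S) → NESplit w)
                 (g : (p : List S) (ps : List (List S)) → Fin (length (p ∷ ps))) →
                 DWins k s' (starA A τ) (starB B g))) →
    -- ¬-move
    DWins k s B A →
    DWins (suc k) s A B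

-- Chain decompositions  w = x₀ c₁^{p₁} x₁ ⋯ c_m^{p_m} x_m  and
-- w' = x₀ c₁^{q₁} x₁ ⋯ c_m^{q_m} x_m .
record Block (S : Set) : Set where
  constructor block
  field
    chr  : S
    lenP : ℕ
    lenQ : ℕ
    sep  : List S   -- the word x_j following the chain
open Block public

renderBlocks : {S : Set} → (Block S → ℕ) → List (Block S) → List S
renderBlocks len []       = []
renderBlocks len (b ∷ bs) = replicate (len b) (chr b) ++ sep b ++ renderBlocks len bs

render : {S : Set} → (Block S → ℕ) → List S → List (Block S) → List S
render len x₀ bs = x₀ ++ renderBlocks len bs

-- Every chain c_j^{len b_j} is a maximal block of c_j's in render len x₀ bs:
-- the letter just before it and the letter just after it differ from c_j.
ChainsMaximal : {S : Set} → (Block S → ℕ) → List S → List (Block S) → Set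
ChainsMaximal len x₀ bs = ∀ bs₁ b bs₂ → bs ≡ bs₁ ++ b ∷ bs₂ →
  (last (x₀ ++ renderBlocks len bs₁) ≢ just (chr b)) ×
  (head (sep b ++ renderBlocks len bs₂) ≢ just (chr b))

-- D keeps the invariant that A contains a word w and B a word w' obtained from w by
-- changing the lengths of chains that are longer than the remaining rank k in both
-- words.  The ¬-move and the ∪-moves preserve it trivially.  For a cat-move with
-- ranks k₁ + k₂ + 1 = k, a cut of w inside a chain c^p is mirrored by a cut of c^q
-- whose left and right parts are each either equal to the corresponding part of c^p
-- or longer than k₁ (resp. k₂) on both sides; this is possible because p, q > k₁ + k₂ + 1.
-- An a-move fails because a word of length at most 1 has no chain longer than k ≥ 1,
-- so w' = w; and s = 0 forbids *-moves.
module Submission where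

open import Defs
open import Data.Nat using (ℕ; zero; suc; _+_; _∸_; _≤_; _<_; z≤n; s≤s; _≤?_)
open import Data.Nat.Properties
open import Data.Nat.Induction using (<-rec)
open import Data.Fin using (Fin)
import Data.Fin as Fin
open import Data.List using (List; []; _∷_; _++_; replicate; length)
open import Data.List.Properties using (∷-injective; ++-assoc; ++-identityʳ)
open import Data.List.Relation.Unary.All using (All; []; _∷_)
open import Data.Maybe using (Maybe; just; nothing)
open import Data.Product using (∃; ∃₂; _×_; _,_; proj₁; proj₂)
open import Data.Sum using (_⊎_; inj₁; inj₂)
open import Function using (_∘_)
open import Relation.Nullary using (yes; no; ¬_; contradiction)
open import Relation.Binary.PropositionalEquality
  using (_≡_; _≢_; refl; sym; trans; cong; subst; subst₂)

private
  variable
    S : Set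
    c : S
    k k₁ k₂ p q : ℕ
    u u' v v' w w' : List S

m+n<o⇒n<o∸m : ∀ {m n o} → m + n < o → n < o ∸ m
m+n<o⇒n<o∸m {m} {n} {o} lt = m+n≤o⇒m≤o∸n (suc n) (subst (_≤ o) (cong suc (+-comm m n)) lt)

EqualOrAbove : ℕ → ℕ → ℕ → Set
EqualOrAbove k a b = a ≡ b ⊎ (k < a × k < b)

equalOrAbove-cap : ∀ k t → ∃ λ u → u ≤ suc k × EqualOrAbove k t u
equalOrAbove-cap k t with t ≤? k
... | yes t≤k = t , m≤n⇒m≤1+n t≤k , inj₁ refl
... | no t≰k  = suc k , ≤-refl , inj₂ (≰⇒> t≰k , n<1+n k)

split-lengths : ∀ k₁ k₂ {t₁ t₂ q} → k₁ + k₂ < t₁ + t₂ → suc (k₁ + k₂) < q →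
  ∃₂ λ q₁ q₂ → q₁ + q₂ ≡ q × EqualOrAbove k₁ t₁ q₁ × EqualOrAbove k₂ t₂ q₂
split-lengths k₁ k₂ {t₁} {t₂} {q} lt lq with t₁ ≤? k₁
... | yes t₁≤k₁ =
  t₁ , q ∸ t₁ , m+[n∸m]≡n (≤-trans (m≤m+n t₁ k₂) (<⇒≤ t₁+k₂<q)) ,
  inj₁ refl , inj₂ (k₂<t₂ , m+n<o⇒n<o∸m t₁+k₂<q)
  where
  t₁+k₂≤k₁+k₂ : t₁ + k₂ ≤ k₁ + k₂
  t₁+k₂≤k₁+k₂ = +-monoˡ-≤ k₂ t₁≤k₁
  k₂<t₂ : k₂ < t₂
  k₂<t₂ = +-cancelˡ-< t₁ k₂ t₂ (≤-<-trans t₁+k₂≤k₁+k₂ lt)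
  t₁+k₂<q : t₁ + k₂ < q
  t₁+k₂<q = ≤-<-trans t₁+k₂≤k₁+k₂ (<-trans (n<1+n _) lq)
... | no t₁≰k₁ with equalOrAbove-cap k₂ t₂
...   | q₂ , q₂≤1+k₂ , eq₂ =
  q ∸ q₂ , q₂ , m∸n+n≡m (≤-trans (m≤m+n q₂ k₁) (<⇒≤ q₂+k₁<q)) ,
  inj₂ (≰⇒> t₁≰k₁ , m+n<o⇒n<o∸m q₂+k₁<q) , eq₂
  where
  q₂+k₁<q : q₂ + k₁ < q
  q₂+k₁<q = ≤-<-trans (+-monoˡ-≤ k₁ q₂≤1+k₂) (subst (_< q) (cong suc (+-comm k₁ k₂)) lq)

replicate-+ : ∀ m n (c : S) → replicate (m + n) c ≡ replicate m c ++ replicate n c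
replicate-+ zero    n c = refl
replicate-+ (suc m) n c = cong (c ∷_) (replicate-+ m n c)

≤-length-replicate-++ : ∀ p (w : List S) → p ≤ length (replicate p c ++ w)
≤-length-replicate-++ zero    w = z≤n
≤-length-replicate-++ (suc p) w = s≤s (≤-length-replicate-++ p w)

++-split : ∀ (u₁ u₂ x w : List S) → u₁ ++ u₂ ≡ x ++ w →
  (∃ λ r → u₁ ≡ x ++ r × r ++ u₂ ≡ w) ⊎ (∃ λ r → x ≡ u₁ ++ r × u₂ ≡ r ++ w)
++-split []       u₂ x       w eq = inj₂ (x , refl , eq)
++-split (a ∷ u₁) u₂ []      w eq = inj₁ (a ∷ u₁ , refl , eq)
++-split (a ∷ u₁) u₂ (b ∷ x) w eq with ∷-injective eq
... | refl , eq′ with ++-split u₁ u₂ x w eq′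
...   | inj₁ (r , refl , e) = inj₁ (r , refl , e)
...   | inj₂ (r , refl , e) = inj₂ (r , refl , e)

++≡replicate : ∀ {p} (u v : List S) → u ++ v ≡ replicate p c →
  ∃₂ λ t₁ t₂ → t₁ + t₂ ≡ p × u ≡ replicate t₁ c × v ≡ replicate t₂ c
++≡replicate         []      v eq = 0 , _ , refl , refl , eq
++≡replicate {p = suc p} (a ∷ u) v eq with ∷-injective eq
... | refl , eq′ with ++≡replicate u v eq′
...   | t₁ , t₂ , refl , refl , refl = suc t₁ , t₂ , refl , refl , refl

data ChainVariant {S : Set} (k : ℕ) : List S → List S → Set where
  []    : ChainVariant k [] []
  _∷_   : ∀ a {w w'} → ChainVariant k w w' → ChainVariant k (a ∷ w) (a ∷ w')
  chain : ∀ c {p q w w'} → k < p → k < q → ChainVariant k w w' →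
          ChainVariant k (replicate p c ++ w) (replicate q c ++ w')

ChainVariant-refl : ∀ (w : List S) → ChainVariant k w w
ChainVariant-refl []      = []
ChainVariant-refl (a ∷ w) = a ∷ ChainVariant-refl w

ChainVariant-sym : ChainVariant k w w' → ChainVariant k w' w
ChainVariant-sym []                = []
ChainVariant-sym (a ∷ v)           = a ∷ ChainVariant-sym v
ChainVariant-sym (chain c lp lq v) = chain c lq lp (ChainVariant-sym v)

ChainVariant-mono : ∀ {j} → j ≤ k → ChainVariant k w w' → ChainVariant j w w'
ChainVariant-mono j≤k []                = []
ChainVariant-mono j≤k (a ∷ v)           = a ∷ ChainVariant-mono j≤k v
ChainVariant-mono j≤k (chain c lp lq v) =
  chain c (≤-<-trans j≤k lp) (≤-<-trans j≤k lq) (ChainVariant-mono j≤k v)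

infixr 5 _++ᵛ_
_++ᵛ_ : ChainVariant k u u' → ChainVariant k v v' → ChainVariant k (u ++ v) (u' ++ v')
[]                ++ᵛ t = t
(a ∷ s)           ++ᵛ t = a ∷ (s ++ᵛ t)
_++ᵛ_ {v = v} {v' = v'} (chain c {p} {q} {w} {w'} lp lq s) t =
  subst₂ (ChainVariant _) (sym (++-assoc (replicate p c) w v)) (sym (++-assoc (replicate q c) w' v'))
    (chain c lp lq (s ++ᵛ t))

replicate-variant : EqualOrAbove k p q → ChainVariant k (replicate p c) (replicate q c)
replicate-variant         (inj₁ refl)      = ChainVariant-refl _
replicate-variant {c = c} (inj₂ (lp , lq)) =
  subst₂ (ChainVariant _) (++-identityʳ _) (++-identityʳ _) (chain c lp lq [])

ChainVariant-short : ChainVariant k w w' → length w ≤ k → w ≡ w'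
ChainVariant-short []      _  = refl
ChainVariant-short (a ∷ v) le = cong (a ∷_) (ChainVariant-short v (<⇒≤ le))
ChainVariant-short (chain c {p} {w = x} lp lq v) le =
  contradiction (≤-trans (≤-length-replicate-++ p x) le) (<⇒≱ lp)

MatchingSplit : ℕ → ℕ → List S → List S → List S → Set
MatchingSplit k₁ k₂ u₁ u₂ w' =
  ∃₂ λ u₁' u₂' → u₁' ++ u₂' ≡ w' × ChainVariant k₁ u₁ u₁' × ChainVariant k₂ u₂ u₂'

chain-split : ∀ {t₁ t₂} → k₁ + k₂ < k → k < t₁ + t₂ → k < q → ChainVariant k w w' →
  MatchingSplit k₁ k₂ (replicate t₁ c) (replicate t₂ c ++ w) (replicate q c ++ w')
chain-split {k₁} {k₂} {q = q} {w' = w'} {c = c} lt lp lq v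
  with split-lengths k₁ k₂ (<-trans lt lp) (≤-<-trans lt lq)
... | q₁ , q₂ , q-sum , eq₁ , eq₂ =
  replicate q₁ c , replicate q₂ c ++ w' , joined ,
  replicate-variant eq₁ , replicate-variant eq₂ ++ᵛ ChainVariant-mono k₂≤k v
  where
  k₂≤k : k₂ ≤ _
  k₂≤k = <⇒≤ (≤-<-trans (m≤n+m k₂ k₁) lt)
  joined : replicate q₁ c ++ replicate q₂ c ++ w' ≡ replicate q c ++ w'
  joined = trans (sym (++-assoc (replicate q₁ c) _ w'))
                 (cong (_++ w') (trans (sym (replicate-+ q₁ q₂ c)) (cong (λ n → replicate n c) q-sum)))

ChainVariant-split : k₁ + k₂ < k → ChainVariant k w w' →
  ∀ u₁ u₂ → u₁ ++ u₂ ≡ w → MatchingSplit k₁ k₂ u₁ u₂ w'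
ChainVariant-split lt []      []       _  refl = [] , [] , refl , [] , []
ChainVariant-split lt []      (_ ∷ _)  _  ()
ChainVariant-split {k₁} {k₂} lt (a ∷ v) [] _ refl =
  [] , _ , refl , [] , ChainVariant-mono (<⇒≤ (≤-<-trans (m≤n+m k₂ k₁) lt)) (a ∷ v)
ChainVariant-split lt (a ∷ v) (.a ∷ u₁) u₂ refl with ChainVariant-split lt v u₁ u₂ refl
... | u₁' , u₂' , refl , v₁ , v₂ = a ∷ u₁' , u₂' , refl , a ∷ v₁ , v₂
ChainVariant-split {k₁} {k₂} lt (chain c {p} {q} lp lq v) u₁ u₂ eq
  with ++-split u₁ u₂ (replicate p c) _ eq
... | inj₁ (r , refl , e) with ChainVariant-split lt v r u₂ e
...   | r' , u₂' , refl , v₁ , v₂ =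
  replicate q c ++ r' , u₂' , ++-assoc (replicate q c) r' u₂' ,
  chain c (≤-<-trans k₁≤k lp) (≤-<-trans k₁≤k lq) v₁ , v₂
  where
  k₁≤k : k₁ ≤ _
  k₁≤k = <⇒≤ (≤-<-trans (m≤m+n k₁ k₂) lt)
ChainVariant-split lt (chain c lp lq v) u₁ u₂ eq
  | inj₂ (x₂ , e , refl) with ++≡replicate u₁ x₂ (sym e)
...   | t₁ , t₂ , refl , refl , refl = chain-split lt lp lq v

render-variant : ∀ k (x₀ : List S) bs → All (λ b → k < lenP b × k < lenQ b) bs →
  ChainVariant k (render lenP x₀ bs) (render lenQ x₀ bs)
render-variant k x₀ bs long = ChainVariant-refl x₀ ++ᵛ blocks bs long
  where
  blocks : ∀ bs → All (λ b → k < lenP b × k < lenQ b) bs →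
    ChainVariant k (renderBlocks lenP bs) (renderBlocks lenQ bs)
  blocks []       []                = []
  blocks (b ∷ bs) ((lp , lq) ∷ long) =
    chain (chr b) lp lq (ChainVariant-refl (sep b) ++ᵛ blocks bs long)

budget-bound : ∀ k₁ k₂ {k} → k₁ + k₂ + 1 ≡ suc k → k₁ + k₂ < suc k
budget-bound k₁ k₂ eq = s≤s (≤-reflexive (suc-injective (trans (+-comm 1 (k₁ + k₂)) eq)))

budget-left : ∀ k₁ k₂ {k} → k₁ + k₂ + 1 ≡ suc k → k₁ < suc k
budget-left k₁ k₂ eq = ≤-<-trans (m≤m+n k₁ k₂) (budget-bound k₁ k₂ eq)

budget-right : ∀ k₁ k₂ {k} → k₁ + k₂ + 1 ≡ suc k → k₂ < suc k
budget-right k₁ k₂ eq = ≤-<-trans (m≤n+m k₂ k₁) (budget-bound k₁ k₂ eq)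

toWord-short : ∀ (a : Maybe S) → length (toWord a) ≤ suc k
toWord-short nothing  = z≤n
toWord-short (just a) = s≤s z≤n

DWinsFrom : (S : Set) → ℕ → Set₁
DWinsFrom S k = ∀ {A B : Lang S} {w w'} → ChainVariant k w w' → A w → B w' → DWins k 0 A B

DWins-of-ChainVariant : ∀ k → DWinsFrom S k
DWins-of-ChainVariant {S} = <-rec (DWinsFrom S) step
  where
  step : ∀ k → (∀ {j} → j < k → DWinsFrom S j) → DWinsFrom S k
  step zero    _  _ _ _ = dw-zero
  step (suc k) ih {A} {B} {w} {w'} v aw bw' =
    dw-suc a-move (λ empty → empty w aw) ∪-move cat-move (λ _ ())
      (ih ≤-refl (ChainVariant-mono (n≤1+n k) (ChainVariant-sym v)) bw' aw)
    where
    a-move : ∀ a → ¬ ((∀ u → A u → u ≡ toWord a) × ¬ B (toWord a))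
    a-move a (forced , ¬B) = ¬B (subst B (trans (sym w≡w') w≡a) bw')
      where
      w≡a : w ≡ toWord a
      w≡a = forced w aw
      w≡w' : w ≡ w'
      w≡w' = ChainVariant-short v (subst (λ u → length u ≤ suc k) (sym w≡a) (toWord-short a))

    ∪-move : ∀ (A₁ A₂ : Lang S) (k₁ k₂ s₁ s₂ : ℕ) →
      A₁ ⊆L A → A₂ ⊆L A → (∀ w → A w → A₁ w ⊎ A₂ w) →
      s₁ ≤ k₁ → s₂ ≤ k₂ → k₁ + k₂ + 1 ≡ suc k → s₁ + s₂ ≡ 0 →
      DWins k₁ s₁ A₁ B ⊎ DWins k₂ s₂ A₂ B
    ∪-move A₁ A₂ k₁ k₂ zero zero _ _ cover _ _ budget refl with cover w aw
    ... | inj₁ a₁ = inj₁ (ih k₁<k (ChainVariant-mono (<⇒≤ k₁<k) v) a₁ bw')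
      where k₁<k = budget-left k₁ k₂ budget
    ... | inj₂ a₂ = inj₂ (ih k₂<k (ChainVariant-mono (<⇒≤ k₂<k) v) a₂ bw')
      where k₂<k = budget-right k₁ k₂ budget

    cat-move : ∀ (σ : (w : List S) → Sp2 w) (f : List S → List S → Fin 2) (k₁ k₂ s₁ s₂ : ℕ) →
      s₁ ≤ k₁ → s₂ ≤ k₂ → k₁ + k₂ + 1 ≡ suc k → s₁ + s₂ ≡ 0 →
      DWins k₁ s₁ (catA₁ A σ) (catB₁ B f) ⊎ DWins k₂ s₂ (catA₂ A σ) (catB₂ B f)
    cat-move σ f k₁ k₂ zero zero _ _ budget refl with σ w in σw
    ... | (u₁ , u₂) , u₁u₂≡w with ChainVariant-split (budget-bound k₁ k₂ budget) v u₁ u₂ u₁u₂≡w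
    ...   | u₁' , u₂' , u₁'u₂'≡w' , v₁ , v₂ with f u₁' u₂' in fu
    ...     | Fin.zero =
      inj₁ (ih (budget-left k₁ k₂ budget) v₁
              (w , aw , cong (proj₁ ∘ proj₁) σw) (u₂' , subst B (sym u₁'u₂'≡w') bw' , fu))
    ...     | Fin.suc Fin.zero =
      inj₂ (ih (budget-right k₁ k₂ budget) v₂
              (w , aw , cong (proj₂ ∘ proj₁) σw) (u₁' , subst B (sym u₁'u₂'≡w') bw' , fu))

lemma5 : ∀ {n : ℕ} (k : ℕ) (A B : Lang (Fin n))
           (x₀ : List (Fin n)) (bs : List (Block (Fin n))) →
           bs ≢ [] →
           All (λ b → k < lenP b × k < lenQ b) bs →
           ChainsMaximal lenP x₀ bs →
           ChainsMaximal lenQ x₀ bs →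
           A (render lenP x₀ bs) →
           B (render lenQ x₀ bs) →
           DWins k 0 A B
lemma5 k A B x₀ bs _ long _ _ aw bw =
  DWins-of-ChainVariant k (render-variant k x₀ bs long) aw bw
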